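{- For $n\geqslant 4$ let $P_n^1=\mathrm{Cay}(\mathrm{Sym}_n,\{r_2,r_{n-1},r_n\})$ and $P_n^2=\mathrm{Cay}(\mathrm{Sym}_n,\{r_{n-2},r_{n-1},r_n\})$; for even $n\geqslant 4$ let $P_n^3=\mathrm{Cay}(\mathrm{Sym}_n,\{r_3,r_{n-2},r_n\})$; for odd $n\geqslant 5$ let $P_n^4=\mathrm{Cay}(\mathrm{Sym}_n,\{r_3,r_{n-1},r_n\})$ and $P_n^5=\mathrm{Cay}(\mathrm{Sym}_n,\{r_{n-3},r_{n-1},r_n\})$. Then: (i) for each $i\in\{1,2,3\}$ (and for $i=3$ with $n$ even), $g(P_n^i)=6$ when $n=4$ and $g(P_n^i)=8$ when $n\geqslant 5$; (ii) $g(P_n^4)=8$ for every odd $n\geqslant 5$; (iii) $g(P_n^5)=8$ when $n=5$, and $g(P_n^5)=12$ for every odd $n\geqslant 7$.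
   Context: Permutations $\pi\in\mathrm{Sym}_n$ are written in one-line notation $\pi=[\pi_1\pi_2\ldots\pi_n]$ with $\pi_i=\pi(i)$. For $2\leqslant i\leqslant n$, the prefix-reversal $r_i\in\mathrm{Sym}_n$ acts by right multiplication reversing the first $i$ entries: $[\pi_1\ldots\pi_i\pi_{i+1}\ldots\pi_n]\,r_i=[\pi_i\ldots\pi_1\pi_{i+1}\ldots\pi_n]$. For a set $S$ of prefix-reversals, $\mathrm{Cay}(\mathrm{Sym}_n,S)$ is the (undirected, simple) Cayley graph with vertex set $\mathrm{Sym}_n$ in which $\pi$ is adjacent to $\pi r$ for each $r\in S$. The girth $g(G)$ of a graph $G$ is the length of a shortest cycle in $G$. -}

module Defs where

open import Data.Nat using (ℕ; suc; _∸_; _≤_; _*_)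
open import Data.Fin using (Fin)
open import Data.List using (List; []; _∷_; _++_; length; take; drop; reverse)
open import Data.List.Membership.Propositional using (_∈_)
open import Data.List.Relation.Unary.All using (All)
open import Data.List.Relation.Unary.Unique.Propositional using (Unique)
open import Data.List.Relation.Unary.Linked using (Linked)
open import Data.Product using (Σ; ∃; _×_)
open import Relation.Binary.PropositionalEquality using (_≡_)

-- One-line notation [π₁ … πₙ] of a map {1..n} → {1..n}, as a list of entries
-- (values written 0-based as elements of Fin n).
OneLine : ℕ → Set
OneLine n = List (Fin n)

IsPerm : (n : ℕ) → OneLine n → Set
IsPerm n xs = (length xs ≡ n) × Unique xs

prefixRev : {A : Set} → ℕ → List A → List A
prefixRev i xs = reverse (take i xs) ++ drop i xs

-- Adjacency in Cay(Sym n, S), S given as the list of indices i of the r_i: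
-- π ~ σ  iff  σ = π r_i for some r_i ∈ S.
Adj : {n : ℕ} → List ℕ → OneLine n → OneLine n → Set
Adj S π σ = Σ ℕ λ i → (i ∈ S) × (σ ≡ prefixRev i π)

-- A cycle v₀ v₁ … v_{k-1} (k = 1 + length ws ≥ 3) in Cay(Sym n, S):
-- pairwise distinct vertices of Sym n, consecutive ones adjacent,
-- and v_{k-1} adjacent to v₀.
Cycle : (n : ℕ) → List ℕ → OneLine n → List (OneLine n) → Set
Cycle n S v ws =
  (2 ≤ length ws)
  × All (IsPerm n) (v ∷ ws)
  × Unique (v ∷ ws)
  × Linked (Adj S) (v ∷ ws ++ (v ∷ []))

GirthIs : (n : ℕ) → List ℕ → ℕ → Set
GirthIs n S g =
  (∃ λ v → ∃ λ ws → Cycle n S v ws × (suc (length ws) ≡ g))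
  × (∀ v ws → Cycle n S v ws → g ≤ suc (length ws))

Even : ℕ → Set
Even n = ∃ λ k → n ≡ 2 * k

Odd : ℕ → Set
Odd n = ∃ λ k → n ≡ suc (2 * k)

P1 P2 P3 P4 P5 : ℕ → List ℕ
P1 n = 2 ∷ (n ∸ 1) ∷ n ∷ []
P2 n = (n ∸ 2) ∷ (n ∸ 1) ∷ n ∷ []
P3 n = 3 ∷ (n ∸ 2) ∷ n ∷ []
P4 n = 3 ∷ (n ∸ 1) ∷ n ∷ []
P5 n = (n ∸ 3) ∷ (n ∸ 1) ∷ n ∷ []

{-# OPTIONS --safe #-}
-- A cycle of length k ≥ 3 through π in Cay(Sym n, S) is a word w of length k
-- in the generators with π w = π whose proper prefixes reach pairwise distinct
-- vertices.  The generators are involutions, so such a word is cyclically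
-- reduced; and whether π u = π w depends only on the maps of positions induced
-- by u and w, not on π.  So the girth is g as soon as one word of length g
-- induces the identity on positions while its proper prefixes induce pairwise
-- different maps, and no cyclically reduced word of length 3 ≤ k < g induces
-- the identity: finitely many computations for each n.
--
-- To treat all large n at once write n = K + K + m.  Positions among the first
-- K, among the last K, and the middle positions K + q together with their
-- mirror images K + (m - 1 - q) are four shapes, each given by an offset.  The
-- reversals r_a (a small) and r_(n-b) map each shape to a shape with an offset
-- computed independently of m, so the same computations run once for every m
-- beyond a bound M₀, which is needed only to tell the first K positions from
-- the last K.
module Submission where

open import Defs
open import Data.Bool using (Bool; true; false; if_then_else_; T; _∧_; _∨_)
open import Data.Bool.ListAction using (all; any)
open import Data.Bool.Properties using (T-∧; T-∨)
open import Data.Fin using (Fin; zero; suc)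
import Data.Fin.Properties as Fin
open import Data.List
  using (List; []; _∷_; _∷ʳ_; _++_; length; take; drop; reverse; map; head; last;
         filter; cartesianProductWith; upTo; allFin; concat; replicate)
open import Data.List.Membership.Propositional using (_∈_; find)
open import Data.List.Membership.Propositional.Properties
  using (∈-map⁺; ∈-map⁻; ∈-filter⁺; ∈-cartesianProductWith⁺; ∈-upTo⁺; ∈-upTo⁻)
open import Data.List.Properties
  using (length-tabulate; length-take; length-reverse; length-++; unfold-reverse;
         take++drop≡id; take-all)
open import Data.List.Relation.Unary.All as All using (All; []; _∷_)
open import Data.List.Relation.Unary.All.Properties using (++⁻ʳ; all⁺; take⁺)
open import Data.List.Relation.Unary.AllPairs using ([]; _∷_)
open import Data.List.Relation.Unary.Any using (here; there)
open import Data.List.Relation.Unary.Any.Properties using (any⁻)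
open import Data.List.Relation.Unary.Linked as Linked using (Linked; []; [-]; _∷_; linked?)
open import Data.List.Relation.Unary.Unique.Propositional using (Unique)
open import Data.List.Relation.Unary.Unique.Propositional.Properties using (allFin⁺)
open import Data.List.Reverse using (reverseView; []; _∶_∶ʳ_)
open import Data.Maybe using (Maybe; just; nothing; is-just; to-witness-T; _>>=_)
import Data.Maybe as Maybe
open import Data.Maybe.Properties using (just-injective; ≡-dec)
open import Data.Nat
  using (ℕ; zero; suc; _+_; _∸_; _≤_; _<_; _<ᵇ_; z≤n; s≤s; z<s; _<?_; _≤?_; _≟_)
open import Data.Nat.Properties
open import Data.Nat.Tactic.RingSolver using (solve-∀)
open import Data.Product using (∃; _×_; _,_; proj₁; proj₂)
import Data.Product.Properties as Product
open import Data.Sum using (_⊎_; inj₁; inj₂)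
open import Function using (_∘_; id)
open import Function.Bundles using (Equivalence)
open import Relation.Binary.Definitions using (DecidableEquality; tri<; tri≈; tri>)
open import Relation.Binary.PropositionalEquality
open import Relation.Nullary using (Dec; ¬_; ¬?; yes; no; contradiction)
open import Relation.Nullary.Decidable using (True; isYes; toWitness; dec⇒maybe)
import Relation.Nullary.Decidable as Dec

private variable
  A : Set
  i j n p : ℕ

mirror : ℕ → ℕ → ℕ
mirror i p = if p <ᵇ i then i ∸ suc p else p

mirror-< : p < i → mirror i p ≡ i ∸ suc p
mirror-< {p} {i} p<i with p <ᵇ i | <⇒<ᵇ p<i
... | true | _ = refl

mirror-≥ : i ≤ p → mirror i p ≡ p
mirror-≥ {i} {p} i≤p with p <ᵇ i in eq
... | false = refl
... | true  = contradiction (<ᵇ⇒< p i (subst T (sym eq) _)) (≤⇒≯ i≤p)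

mirror-+ : ∀ p d → mirror (suc p + d) p ≡ d
mirror-+ p d = trans (mirror-< (s≤s (m≤m+n p d))) (m+n∸m≡n p d)

mirror-involutive : ∀ i p → mirror i (mirror i p) ≡ p
mirror-involutive i p with p <? i
... | no p≮i = trans (cong (mirror i) (mirror-≥ (≮⇒≥ p≮i))) (mirror-≥ (≮⇒≥ p≮i))
... | yes p<i with d , refl ← m≤n⇒∃[o]m+o≡n p<i = begin
  mirror (suc p + d) (mirror (suc p + d) p) ≡⟨ cong (mirror (suc p + d)) (mirror-+ p d) ⟩
  mirror (suc p + d) d                      ≡⟨ cong (λ i → mirror (suc i) d) (+-comm p d) ⟩
  mirror (suc d + p) d                      ≡⟨ mirror-+ d p ⟩
  p                                         ∎
  where open ≡-Reasoning

mirror-bounded : i ≤ n → p < n → mirror i p < n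
mirror-bounded {i} {n} {p} i≤n p<n with p <? i
... | yes p<i = subst (_< n) (sym (mirror-< p<i)) (<-≤-trans (∸-monoʳ-< z<s p<i) i≤n)
... | no p≮i  = subst (_< n) (sym (mirror-≥ (≮⇒≥ p≮i))) p<n

at : List A → ℕ → Maybe A
at []       _       = nothing
at (x ∷ xs) zero    = just x
at (x ∷ xs) (suc j) = at xs j

at-++ˡ : ∀ (xs ys : List A) → j < length xs → at (xs ++ ys) j ≡ at xs j
at-++ˡ {j = zero}  (x ∷ xs) ys _         = refl
at-++ˡ {j = suc j} (x ∷ xs) ys (s≤s j<l) = at-++ˡ xs ys j<l

at-++ʳ : ∀ (xs ys : List A) → length xs ≤ j → at (xs ++ ys) j ≡ at ys (j ∸ length xs)
at-++ʳ             []       ys _         = refl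
at-++ʳ {j = suc j} (x ∷ xs) ys (s≤s l≤j) = at-++ʳ xs ys l≤j

at-take : ∀ (xs : List A) → j < i → at (take i xs) j ≡ at xs j
at-take {j = j}     {suc i} []       _         = refl
at-take {j = zero}  {suc i} (x ∷ xs) _         = refl
at-take {j = suc j} {suc i} (x ∷ xs) (s≤s j<i) = at-take xs j<i

at-drop : ∀ (xs : List A) i j → at (drop i xs) j ≡ at xs (i + j)
at-drop xs       zero    j = refl
at-drop []       (suc i) j = refl
at-drop (x ∷ xs) (suc i) j = at-drop xs i j

at-reverse : ∀ (xs : List A) → j < length xs → at (reverse xs) j ≡ at xs (length xs ∸ suc j)
at-reverse {j = j} (x ∷ xs) j<1+l rewrite unfold-reverse x xs with j <? length xs
... | yes j<l = begin
  at (reverse xs ++ x ∷ []) j           ≡⟨ at-++ˡ (reverse xs) _ (subst (j <_) (sym |rxs|) j<l) ⟩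
  at (reverse xs) j                     ≡⟨ at-reverse xs j<l ⟩
  at xs (length xs ∸ suc j)             ≡⟨ cong (at (x ∷ xs)) (+-∸-assoc 1 j<l) ⟨
  at (x ∷ xs) (suc (length xs) ∸ suc j) ∎
  where
  open ≡-Reasoning
  |rxs| = length-reverse xs
... | no j≮l with refl ← ≤-antisym (≤-pred j<1+l) (≮⇒≥ j≮l) = begin
  at (reverse xs ++ x ∷ []) (length xs)         ≡⟨ at-++ʳ (reverse xs) _ (≤-reflexive |rxs|) ⟩
  at (x ∷ []) (length xs ∸ length (reverse xs)) ≡⟨ cong (λ l → at (x ∷ []) (length xs ∸ l)) |rxs| ⟩
  at (x ∷ []) (length xs ∸ length xs)           ≡⟨ cong (at (x ∷ [])) (n∸n≡0 (length xs)) ⟩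
  just x                                        ≡⟨ cong (at (x ∷ xs)) (n∸n≡0 (length xs)) ⟨
  at (x ∷ xs) (length xs ∸ length xs)           ∎
  where
  open ≡-Reasoning
  |rxs| = length-reverse xs

at-ext : ∀ (xs ys : List A) → (∀ j → at xs j ≡ at ys j) → xs ≡ ys
at-ext []       []       _  = refl
at-ext []       (y ∷ ys) eq with () ← eq 0
at-ext (x ∷ xs) []       eq with () ← eq 0
at-ext (x ∷ xs) (y ∷ ys) eq with refl ← eq 0 = cong (x ∷_) (at-ext xs ys (eq ∘ suc))

at-just : ∀ (xs : List A) → j < length xs → ∃ λ a → at xs j ≡ just a
at-just {j = zero}  (x ∷ xs) _         = x , refl
at-just {j = suc j} (x ∷ xs) (s≤s j<l) = at-just xs j<l

at-just⇒< : ∀ (xs : List A) {a} → at xs j ≡ just a → j < length xs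
at-just⇒< {j = zero}  (x ∷ xs) _ = z<s
at-just⇒< {j = suc j} (x ∷ xs) e = s≤s (at-just⇒< xs e)

at⇒∈ : ∀ (xs : List A) {a} → at xs j ≡ just a → a ∈ xs
at⇒∈ {j = zero}  (x ∷ xs) refl = here refl
at⇒∈ {j = suc j} (x ∷ xs) e    = there (at⇒∈ xs e)

∈⇒at : ∀ {xs : List A} {a} → a ∈ xs → ∃ λ j → at xs j ≡ just a
∈⇒at (here refl)  = 0 , refl
∈⇒at (there a∈xs) with j , e ← ∈⇒at a∈xs = suc j , e

Unique⇒at-injective : ∀ {xs : List A} {a} → Unique xs →
                      at xs i ≡ just a → at xs j ≡ just a → i ≡ j
Unique⇒at-injective {i = zero}  {j = zero}                 _          _    _    = refl
Unique⇒at-injective {i = zero}  {j = suc j} {xs = _ ∷ xs} (x∉ ∷ _)   refl e    =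
  contradiction refl (All.lookup x∉ (at⇒∈ xs e))
Unique⇒at-injective {i = suc i} {j = zero}  {xs = _ ∷ xs} (x∉ ∷ _)   e    refl =
  contradiction refl (All.lookup x∉ (at⇒∈ xs e))
Unique⇒at-injective {i = suc i} {j = suc j}               (_ ∷ uniq) e    e'   =
  cong suc (Unique⇒at-injective uniq e e')

at-injective⇒Unique : ∀ (xs : List A) →
                      (∀ {i j a} → at xs i ≡ just a → at xs j ≡ just a → i ≡ j) → Unique xs
at-injective⇒Unique []       _   = []
at-injective⇒Unique (x ∷ xs) inj =
  All.tabulate x∉xs ∷ at-injective⇒Unique xs (λ e e' → suc-injective (inj e e'))
  where
  x∉xs : ∀ {y} → y ∈ xs → x ≢ y
  x∉xs y∈xs refl with j , e ← ∈⇒at y∈xs with () ← inj {0} {suc j} refl e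

<-separated⇒injective : ∀ {B : Set} {k} (f : ℕ → B) → (∀ {i j} → i < j → j < k → f i ≢ f j) →
                        i < k → j < k → f i ≡ f j → i ≡ j
<-separated⇒injective {i = i} {j = j} f sep i<k j<k eq with <-cmp i j
... | tri< i<j _ _ = contradiction eq (sep i<j j<k)
... | tri≈ _ i≡j _ = i≡j
... | tri> _ _ j<i = contradiction (sym eq) (sep j<i i<k)

length-take-≤ : ∀ (xs : List A) → i ≤ length xs → length (take i xs) ≡ i
length-take-≤ {i = i} xs i≤l = trans (length-take i xs) (m≤n⇒m⊓n≡m i≤l)

take-length-++ : ∀ (xs ys : List A) → take (length xs) (xs ++ ys) ≡ xs
take-length-++ []       ys = refl
take-length-++ (x ∷ xs) ys = cong (x ∷_) (take-length-++ xs ys)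

take-++-length : ∀ (xs ys : List A) j → take (length xs + j) (xs ++ ys) ≡ xs ++ take j ys
take-++-length []       ys j = refl
take-++-length (x ∷ xs) ys j = cong (x ∷_) (take-++-length xs ys j)

last-∷ʳ : ∀ (xs : List A) x → last (xs ∷ʳ x) ≡ just x
last-∷ʳ []           x = refl
last-∷ʳ (y ∷ [])     x = refl
last-∷ʳ (y ∷ z ∷ xs) x = last-∷ʳ (z ∷ xs) x

module _ {A : Set} where
  open import Data.List.Relation.Binary.Permutation.Setoid (setoid A)
    using (_↭_; ↭-reflexive; ↭-sym; ↭-trans)
  open import Data.List.Relation.Binary.Permutation.Setoid.Properties (setoid A)
    using (↭-reverse; ++⁺ʳ; Unique-resp-↭; xs↭ys⇒|xs|≡|ys|)

  prefixRev-↭ : ∀ i (xs : List A) → prefixRev i xs ↭ xs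
  prefixRev-↭ i xs =
    ↭-trans (++⁺ʳ (drop i xs) (↭-reverse (take i xs))) (↭-reflexive (take++drop≡id i xs))

  length-prefixRev : ∀ i (xs : List A) → length (prefixRev i xs) ≡ length xs
  length-prefixRev i xs = xs↭ys⇒|xs|≡|ys| (prefixRev-↭ i xs)

  Unique-prefixRev : ∀ i {xs : List A} → Unique xs → Unique (prefixRev i xs)
  Unique-prefixRev i {xs} = Unique-resp-↭ (↭-sym (prefixRev-↭ i xs))

at-prefixRev : ∀ (xs : List A) → i ≤ length xs → ∀ j → at (prefixRev i xs) j ≡ at xs (mirror i j)
at-prefixRev {i = i} xs i≤l j with j <? i
... | yes j<i = begin
  at (reverse (take i xs) ++ drop i xs) j     ≡⟨ at-++ˡ (reverse (take i xs)) _ (subst (j <_) (sym |rt|) j<i) ⟩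
  at (reverse (take i xs)) j                  ≡⟨ at-reverse (take i xs) (subst (j <_) (sym |t|) j<i) ⟩
  at (take i xs) (length (take i xs) ∸ suc j) ≡⟨ cong (λ l → at (take i xs) (l ∸ suc j)) |t| ⟩
  at (take i xs) (i ∸ suc j)                  ≡⟨ at-take xs (∸-monoʳ-< z<s j<i) ⟩
  at xs (i ∸ suc j)                           ≡⟨ cong (at xs) (mirror-< j<i) ⟨
  at xs (mirror i j)                          ∎
  where
  open ≡-Reasoning
  |t|  = length-take-≤ xs i≤l
  |rt| = trans (length-reverse (take i xs)) |t|
... | no j≮i = begin
  at (reverse (take i xs) ++ drop i xs) j
    ≡⟨ at-++ʳ (reverse (take i xs)) _ (subst (_≤ j) (sym |rt|) (≮⇒≥ j≮i)) ⟩
  at (drop i xs) (j ∸ length (reverse (take i xs))) ≡⟨ cong (λ l → at (drop i xs) (j ∸ l)) |rt| ⟩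
  at (drop i xs) (j ∸ i)                            ≡⟨ at-drop xs i (j ∸ i) ⟩
  at xs (i + (j ∸ i))                               ≡⟨ cong (at xs) (m+[n∸m]≡n (≮⇒≥ j≮i)) ⟩
  at xs j                                           ≡⟨ cong (at xs) (mirror-≥ (≮⇒≥ j≮i)) ⟨
  at xs (mirror i j)                                ∎
  where
  open ≡-Reasoning
  |rt| = trans (length-reverse (take i xs)) (length-take-≤ xs i≤l)

prefixRev-involutive : ∀ (xs : List A) → i ≤ length xs → prefixRev i (prefixRev i xs) ≡ xs
prefixRev-involutive {i = i} xs i≤l = at-ext _ _ λ j → begin
  at (prefixRev i (prefixRev i xs)) j ≡⟨ at-prefixRev (prefixRev i xs) i≤l′ j ⟩
  at (prefixRev i xs) (mirror i j)    ≡⟨ at-prefixRev xs i≤l (mirror i j) ⟩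
  at xs (mirror i (mirror i j))       ≡⟨ cong (at xs) (mirror-involutive i j) ⟩
  at xs j                             ∎
  where
  open ≡-Reasoning
  i≤l′ = subst (i ≤_) (sym (length-prefixRev i xs)) i≤l

-- Words and their action on one-line notation

-- r[ a ] is r_a and r[n- b ] is r_(n-b), so that one word names a walk in every Sym n.
data Letter : Set where
  r[_]   : ℕ → Letter
  r[n-_] : ℕ → Letter

index : ℕ → Letter → ℕ
index n r[ a ]   = a
index n r[n- b ] = n ∸ b

_≟ₗ_ : DecidableEquality Letter
r[ a ]   ≟ₗ r[ b ]   = Dec.map′ (cong r[_]) (λ { refl → refl }) (a ≟ b)
r[n- a ] ≟ₗ r[n- b ] = Dec.map′ (cong r[n-_]) (λ { refl → refl }) (a ≟ b)
r[ _ ]   ≟ₗ r[n- _ ] = no λ ()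
r[n- _ ] ≟ₗ r[ _ ]   = no λ ()

Word : Set
Word = List Letter

Fits : ℕ → Word → Set
Fits n = All (λ g → index n g ≤ n)

infixl 5 _·_

_·_ : ∀ {n} → OneLine n → Word → OneLine n
x · []            = x
_·_ {n} x (g ∷ w) = prefixRev (index n g) x · w

origin : ℕ → Word → ℕ → ℕ
origin n []      p = p
origin n (g ∷ w) p = mirror (index n g) (origin n w p)

path : ∀ {n} → OneLine n → Word → List (OneLine n)
path x []          = []
path {n} x (g ∷ w) = prefixRev (index n g) x ∷ path (prefixRev (index n g) x) w

module _ {n : ℕ} where

  length-· : ∀ (x : OneLine n) w → length (x · w) ≡ length x
  length-· x []      = refl
  length-· x (g ∷ w) = trans (length-· _ w) (length-prefixRev (index n g) x)

  at-· : ∀ (x : OneLine n) {w} → Fits n w → length x ≡ n → ∀ p → at (x · w) p ≡ at x (origin n w p)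
  at-· x {[]}    []         _   p = refl
  at-· x {g ∷ w} (g≤n ∷ ws) |x| p = begin
    at (prefixRev (index n g) x · w) p          ≡⟨ at-· _ ws (trans (length-prefixRev (index n g) x) |x|) p ⟩
    at (prefixRev (index n g) x) (origin n w p) ≡⟨ at-prefixRev x (subst (index n g ≤_) (sym |x|) g≤n) _ ⟩
    at x (mirror (index n g) (origin n w p))    ∎
    where open ≡-Reasoning

  ·-++ : ∀ (x : OneLine n) u w → x · (u ++ w) ≡ x · u · w
  ·-++ x []      w = refl
  ·-++ x (g ∷ u) w = ·-++ _ u w

  ·-involutive : ∀ (x : OneLine n) {g} → length x ≡ n → index n g ≤ n → x · (g ∷ g ∷ []) ≡ x
  ·-involutive x {g} |x| g≤n = prefixRev-involutive x (subst (index n g ≤_) (sym |x|) g≤n)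

  IsPerm-· : ∀ {x : OneLine n} w → IsPerm n x → IsPerm n (x · w)
  IsPerm-· []      π            = π
  IsPerm-· (g ∷ w) (|x| , uniq) =
    IsPerm-· w (trans (length-prefixRev (index n g) _) |x| , Unique-prefixRev (index n g) uniq)

  IsPerm-path : ∀ {x : OneLine n} w → IsPerm n x → All (IsPerm n) (path x w)
  IsPerm-path []      π = []
  IsPerm-path (g ∷ w) π = IsPerm-· (g ∷ []) π ∷ IsPerm-path w (IsPerm-· (g ∷ []) π)

  length-path : ∀ (x : OneLine n) w → length (path x w) ≡ length w
  length-path x []      = refl
  length-path x (g ∷ w) = cong suc (length-path _ w)

  path-∷ʳ : ∀ (x : OneLine n) w g → path x (w ∷ʳ g) ≡ path x w ∷ʳ (x · (w ∷ʳ g))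
  path-∷ʳ x []      g = refl
  path-∷ʳ x (h ∷ w) g = cong (_ ∷_) (path-∷ʳ _ w g)

  at-path : ∀ (x : OneLine n) w → j ≤ length w → at (x ∷ path x w) j ≡ just (x · take j w)
  at-path {j = zero}  x w       _         = refl
  at-path {j = suc j} x (g ∷ w) (s≤s j≤l) = at-path _ w j≤l

Fixes : ℕ → Word → Set
Fixes n w = ∀ {p} → p < n → origin n w p ≡ p

Separates : ℕ → Word → Word → Set
Separates n u w = ∃ λ p → p < n × origin n u p ≢ origin n w p

module _ {n : ℕ} where

  origin-bounded : ∀ {w} → Fits n w → p < n → origin n w p < n
  origin-bounded []         p<n = p<n
  origin-bounded (g≤n ∷ ws) p<n = mirror-bounded g≤n (origin-bounded ws p<n)

  origin-≥ : ∀ {w} → Fits n w → n ≤ p → origin n w p ≡ p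
  origin-≥             []         n≤p = refl
  origin-≥ {w = g ∷ _} (g≤n ∷ ws) n≤p =
    trans (cong (mirror (index n g)) (origin-≥ ws n≤p)) (mirror-≥ (≤-trans g≤n n≤p))

  at-injective : ∀ {x : OneLine n} → IsPerm n x → i < n → at x i ≡ at x j → i ≡ j
  at-injective {x = x} (|x| , uniq) i<n eq
    with a , e ← at-just x (subst (_ <_) (sym |x|) i<n) = Unique⇒at-injective uniq e (trans (sym eq) e)

  Fixes⇒closed : ∀ (x : OneLine n) {w} → length x ≡ n → Fits n w → Fixes n w → x · w ≡ x
  Fixes⇒closed x {w} |x| ws fixes = at-ext _ _ λ p → trans (at-· x ws |x| p) (cong (at x) (fixed p))
    where
    fixed : ∀ p → origin n w p ≡ p
    fixed p with p <? n
    ... | yes p<n = fixes p<n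
    ... | no p≮n  = origin-≥ ws (≮⇒≥ p≮n)

  closed⇒Fixes : ∀ {x : OneLine n} {w} → IsPerm n x → Fits n w → x · w ≡ x → Fixes n w
  closed⇒Fixes {x} {w} π ws closed {p} p<n = sym (at-injective π p<n (begin
    at x p              ≡⟨ cong (λ y → at y p) closed ⟨
    at (x · w) p        ≡⟨ at-· x ws (proj₁ π) p ⟩
    at x (origin n w p) ∎))
    where open ≡-Reasoning

  Separates⇒≢ : ∀ {x : OneLine n} {u w} → IsPerm n x → Fits n u → Fits n w →
                Separates n u w → x · u ≢ x · w
  Separates⇒≢ {x} {u} {w} π us ws (p , p<n , differ) eq =
    differ (at-injective π (origin-bounded us p<n) (begin
      at x (origin n u p) ≡⟨ at-· x us (proj₁ π) p ⟨
      at (x · u) p        ≡⟨ cong (λ y → at y p) eq ⟩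
      at (x · w) p        ≡⟨ at-· x ws (proj₁ π) p ⟩
      at x (origin n w p) ∎))
    where open ≡-Reasoning

-- Cycles and closed words

record SimpleClosedWord {n} (x : OneLine n) (w : Word) : Set where
  field
    long     : 3 ≤ length w
    closed   : x · w ≡ x
    distinct : ∀ {i j} → i < j → j < length w → x · take i w ≢ x · take j w

module _ {n : ℕ} (L : List Letter) where

  private
    Step : OneLine n → OneLine n → Set
    Step = Adj (map (index n) L)

  walk⇒word : ∀ (x : OneLine n) ys → Linked Step (x ∷ ys) → ∃ λ w → All (_∈ L) w × ys ≡ path x w
  walk⇒word x []       _                          = [] , [] , refl
  walk⇒word x (y ∷ ys) ((i , i∈S , refl) ∷ steps)
    with g , g∈L , refl ← ∈-map⁻ (index n) i∈S
       | w , w⊆L , refl ← walk⇒word y ys steps = g ∷ w , g∈L ∷ w⊆L , refl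

  word⇒walk : ∀ (x : OneLine n) {w} → All (_∈ L) w → Linked Step (x ∷ path x w)
  word⇒walk x         []          = [-]
  word⇒walk x {g ∷ _} (g∈L ∷ w⊆L) = (index n g , ∈-map⁺ (index n) g∈L , refl) ∷ word⇒walk _ w⊆L

module _ {n : ℕ} {v : OneLine n} {ws w} (walk : ws ++ v ∷ [] ≡ path v w) where

  closedWalk-length : suc (length ws) ≡ length w
  closedWalk-length = begin
    suc (length ws)       ≡⟨ +-comm 1 (length ws) ⟩
    length ws + 1         ≡⟨ length-++ ws ⟨
    length (ws ++ v ∷ []) ≡⟨ cong length walk ⟩
    length (path v w)     ≡⟨ length-path v w ⟩
    length w              ∎
    where open ≡-Reasoning

  closedWalk-at : j < length w → at (v ∷ ws) j ≡ just (v · take j w)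
  closedWalk-at {j} j<k = begin
    at (v ∷ ws) j           ≡⟨ at-++ˡ (v ∷ ws) (v ∷ []) (subst (j <_) (sym closedWalk-length) j<k) ⟨
    at (v ∷ ws ++ v ∷ []) j ≡⟨ cong (λ ys → at (v ∷ ys) j) walk ⟩
    at (v ∷ path v w) j     ≡⟨ at-path v w (<⇒≤ j<k) ⟩
    just (v · take j w)     ∎
    where open ≡-Reasoning

  closedWalk-closed : v · w ≡ v
  closedWalk-closed = just-injective (begin
    just (v · w)                             ≡⟨ cong (λ u → just (v · u)) (take-all _ w ≤-refl) ⟨
    just (v · take (length w) w)             ≡⟨ at-path v w ≤-refl ⟨
    at (v ∷ path v w) (length w)             ≡⟨ cong (λ ys → at (v ∷ ys) (length w)) walk ⟨
    at ((v ∷ ws) ++ v ∷ []) (length w)       ≡⟨ at-++ʳ (v ∷ ws) (v ∷ []) (≤-reflexive closedWalk-length) ⟩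
    at (v ∷ []) (length w ∸ suc (length ws)) ≡⟨ cong (λ k → at (v ∷ []) (length w ∸ k)) closedWalk-length ⟩
    at (v ∷ []) (length w ∸ length w)        ≡⟨ cong (at (v ∷ [])) (n∸n≡0 (length w)) ⟩
    just v                                   ∎)
    where open ≡-Reasoning

module _ {n : ℕ} (L : List Letter) where

  cycle⇒simpleClosedWord : ∀ {v : OneLine n} {ws} → Cycle n (map (index n) L) v ws →
    ∃ λ w → All (_∈ L) w × suc (length ws) ≡ length w × SimpleClosedWord v w
  cycle⇒simpleClosedWord {v} {ws} (2≤|ws| , _ , uniq , steps)
    with w , w⊆L , walk ← walk⇒word L v (ws ++ v ∷ []) steps = w , w⊆L , |w| , record
    { long     = subst (3 ≤_) |w| (s≤s 2≤|ws|)
    ; closed   = closedWalk-closed walk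
    ; distinct = λ i<j j<k eq → <⇒≢ i<j (Unique⇒at-injective uniq
        (closedWalk-at walk (<-trans i<j j<k)) (trans (closedWalk-at walk j<k) (cong just (sym eq))))
    }
    where |w| = closedWalk-length walk

  simpleClosedWord⇒cycle : ∀ {v : OneLine n} {w} → IsPerm n v → All (_∈ L) w → SimpleClosedWord v w →
    ∃ λ ws → Cycle n (map (index n) L) v ws × suc (length ws) ≡ length w
  simpleClosedWord⇒cycle {v} {w} π w⊆L scw with reverseView w
  ... | []          = contradiction (SimpleClosedWord.long scw) λ ()
  ... | w₀ ∶ _ ∶ʳ g =
    path v w₀ , (2≤|ws| , π ∷ IsPerm-path w₀ π , uniq , steps) , closedWalk-length walk
    where
    open SimpleClosedWord scw
    walk : path v w₀ ++ v ∷ [] ≡ path v (w₀ ∷ʳ g)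
    walk = trans (cong (path v w₀ ∷ʳ_) (sym closed)) (sym (path-∷ʳ v w₀ g))
    2≤|ws| : 2 ≤ length (path v w₀)
    2≤|ws| = ≤-pred (subst (3 ≤_) (sym (closedWalk-length walk)) long)
    uniq : Unique (v ∷ path v w₀)
    uniq = at-injective⇒Unique _ λ {i} {j} e e' →
      let i<k = subst (i <_) (closedWalk-length walk) (at-just⇒< (v ∷ path v w₀) e)
          j<k = subst (j <_) (closedWalk-length walk) (at-just⇒< (v ∷ path v w₀) e')
      in <-separated⇒injective (λ i → v · take i (w₀ ∷ʳ g)) distinct i<k j<k (just-injective
           (trans (sym (closedWalk-at walk i<k)) (trans e (trans (sym e') (closedWalk-at walk j<k)))))
    steps : Linked (Adj (map (index n) L)) (v ∷ path v w₀ ++ v ∷ [])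
    steps = subst (λ ys → Linked _ (v ∷ ys)) (sym walk) (word⇒walk L v w⊆L)

Backtrack : Word → Set
Backtrack w = ∃ λ u → ∃ λ u' → ∃ λ g → w ≡ u ++ g ∷ g ∷ u'

reduced-or-backtrack : ∀ w → Linked _≢_ w ⊎ Backtrack w
reduced-or-backtrack []          = inj₁ []
reduced-or-backtrack (g ∷ [])    = inj₁ [-]
reduced-or-backtrack (g ∷ h ∷ w) with g ≟ₗ h | reduced-or-backtrack (h ∷ w)
... | yes refl | _                         = inj₂ ([] , w , g , refl)
... | no g≢h   | inj₁ reduced              = inj₁ (g≢h ∷ reduced)
... | no _     | inj₂ (u , u' , a , split) = inj₂ (g ∷ u , u' , a , cong (g ∷_) split)

CyclicallyReduced : Word → Set
CyclicallyReduced w = Linked _≢_ w × head w ≢ last w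

module _ {n : ℕ} {v : OneLine n} {w : Word}
         (|v| : length v ≡ n) (ws : Fits n w) (scw : SimpleClosedWord v w) where

  open SimpleClosedWord scw

  private
    returns-after-backtrack : ∀ u g u' → w ≡ u ++ g ∷ g ∷ u' →
                              v · take (length u + 2) w ≡ v · take (length u) w
    returns-after-backtrack u g u' refl with g≤n ∷ _ ← ++⁻ʳ u ws = begin
      v · take (length u + 2) (u ++ g ∷ g ∷ u') ≡⟨ cong (v ·_) (take-++-length u _ 2) ⟩
      v · (u ++ g ∷ g ∷ [])                     ≡⟨ ·-++ v u _ ⟩
      v · u · (g ∷ g ∷ [])                      ≡⟨ ·-involutive (v · u) {g} (trans (length-· v u) |v|) g≤n ⟩
      v · u                                     ≡⟨ cong (v ·_) (take-length-++ u _) ⟨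
      v · take (length u) (u ++ g ∷ g ∷ u')     ∎
      where open ≡-Reasoning

  no-backtrack : ¬ Backtrack w
  no-backtrack (u , u' , g , split)
    with back ← returns-after-backtrack u g u' split | length u + 2 <? length w
  ... | yes |u|+2<k = distinct (m<m+n (length u) z<s) |u|+2<k (sym back)
  ... | no  |u|+2≮k = distinct 0<|u| |u|<k (sym (begin
    v · take (length u) w     ≡⟨ back ⟨
    v · take (length u + 2) w ≡⟨ cong (v ·_) (take-all _ w (≮⇒≥ |u|+2≮k)) ⟩
    v · w                     ≡⟨ closed ⟩
    v                         ∎))
    where
    open ≡-Reasoning
    |u|<k : length u < length w
    |u|<k = subst (length u <_) (sym (trans (cong length split) (length-++ u))) (m<m+n (length u) z<s)
    0<|u| : 0 < length u
    0<|u| = +-cancelʳ-≤ 2 1 (length u) (≤-trans long (≮⇒≥ |u|+2≮k))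

  ends-differ : head w ≢ last w
  ends-differ ends with reverseView w
  ... | []           = contradiction long λ ()
  ... | [] ∶ _ ∶ʳ h  = contradiction long λ { (s≤s ()) }
  ... | (g ∷ u) ∶ _ ∶ʳ h with refl ← just-injective (trans ends (last-∷ʳ (g ∷ u) h)) =
    distinct 1<|gu| (subst (length (g ∷ u) <_) (sym |w|) ≤-refl) (sym (begin
      v · take (length (g ∷ u)) ((g ∷ u) ∷ʳ g) ≡⟨ cong (v ·_) (take-length-++ (g ∷ u) _) ⟩
      v · (g ∷ u)                               ≡⟨ ·-involutive (v · (g ∷ u)) {g} |v·gu| (All.head ws) ⟨
      v · (g ∷ u) · (g ∷ g ∷ [])                ≡⟨ cong (_· (g ∷ [])) (·-++ v (g ∷ u) (g ∷ [])) ⟨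
      v · ((g ∷ u) ∷ʳ g) · (g ∷ [])             ≡⟨ cong (_· (g ∷ [])) closed ⟩
      v · (g ∷ [])                              ∎))
    where
    open ≡-Reasoning
    |v·gu| = trans (length-· v (g ∷ u)) |v|
    |w| : length ((g ∷ u) ∷ʳ g) ≡ 2 + length u
    |w| = cong suc (trans (length-++ u) (+-comm (length u) 1))
    1<|gu| : 1 < length (g ∷ u)
    1<|gu| = s≤s (≤-pred (≤-pred (subst (3 ≤_) |w| long)))

  cyclicallyReduced : CyclicallyReduced w
  cyclicallyReduced with reduced-or-backtrack w
  ... | inj₁ reduced   = reduced , ends-differ
  ... | inj₂ backtrack = contradiction backtrack no-backtrack

reducedWords : List Letter → ℕ → List Word
reducedWords L zero    = [] ∷ []
reducedWords L (suc k) =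
  filter (linked? λ g h → ¬? (g ≟ₗ h)) (cartesianProductWith _∷_ L (reducedWords L k))

cyclicallyReducedWords : List Letter → ℕ → List Word
cyclicallyReducedWords L k = filter (λ w → ¬? (≡-dec _≟ₗ_ (head w) (last w))) (reducedWords L k)

module _ {L : List Letter} where

  ∈-reducedWords : ∀ {w} → All (_∈ L) w → Linked _≢_ w → w ∈ reducedWords L (length w)
  ∈-reducedWords []          _       = here refl
  ∈-reducedWords (g∈L ∷ w⊆L) reduced = ∈-filter⁺ (linked? λ g h → ¬? (g ≟ₗ h))
    (∈-cartesianProductWith⁺ _∷_ g∈L (∈-reducedWords w⊆L (Linked.tail reduced))) reduced

  ∈-cyclicallyReducedWords : ∀ {w} → All (_∈ L) w → CyclicallyReduced w →
                             w ∈ cyclicallyReducedWords L (length w)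
  ∈-cyclicallyReducedWords w⊆L (reduced , ends) =
    ∈-filter⁺ (λ w → ¬? (≡-dec _≟ₗ_ (head w) (last w))) (∈-reducedWords w⊆L reduced) ends

record Certifier (n : ℕ) : Set where
  field
    separates?      : Word → Word → Bool
    separates-sound : ∀ u w → T (separates? u w) → Separates n u w
    fixes?          : Word → Bool
    fixes-sound     : ∀ w → T (fixes? w) → Fixes n w

  lowerCheck : List Letter → ℕ → Bool
  lowerCheck L g =
    all (λ k → all (λ w → separates? w []) (cyclicallyReducedWords L k)) (filter (3 ≤?_) (upTo g))

  upperCheck : Word → Bool
  upperCheck w =
    fixes? w ∧ all (λ j → all (λ i → separates? (take i w) (take j w)) (upTo j)) (upTo (length w))

  lowerCheck-sound : ∀ {L g k w} → T (lowerCheck L g) → 3 ≤ k → k < g →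
                     w ∈ cyclicallyReducedWords L k → Separates n w []
  lowerCheck-sound check 3≤k k<g w∈words = separates-sound _ []
    (All.lookup (all⁺ _ _ (All.lookup (all⁺ _ _ check) (∈-filter⁺ (3 ≤?_) (∈-upTo⁺ k<g) 3≤k))) w∈words)

  upperCheck-sound : ∀ {w} → T (upperCheck w) →
    Fixes n w × (∀ {i j} → i < j → j < length w → Separates n (take i w) (take j w))
  upperCheck-sound {w} check with fixed , separated ← Equivalence.to T-∧ check =
    fixes-sound w fixed , λ i<j j<k → separates-sound _ _
      (All.lookup (all⁺ _ _ (All.lookup (all⁺ _ _ separated) (∈-upTo⁺ j<k))) (∈-upTo⁺ i<j))

module _ {n : ℕ} (C : Certifier n) {L : List Letter} (L-fits : Fits n L) where

  open Certifier C

  private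
    fits : ∀ {w} → All (_∈ L) w → Fits n w
    fits = All.map (All.lookup L-fits)

  girth-≥ : ∀ {g} → T (lowerCheck L g) → ∀ v ws → Cycle n (map (index n) L) v ws → g ≤ suc (length ws)
  girth-≥ {g} check v ws cycle@(_ , π ∷ _ , _) with g ≤? suc (length ws)
  ... | yes g≤k = g≤k
  ... | no g≰k with w , w⊆L , |w| , scw ← cycle⇒simpleClosedWord L cycle
    with p , p<n , moved ← lowerCheck-sound check (SimpleClosedWord.long scw) (subst (_< g) |w| (≰⇒> g≰k))
                             (∈-cyclicallyReducedWords w⊆L (cyclicallyReduced (proj₁ π) (fits w⊆L) scw)) =
    contradiction (closed⇒Fixes π (fits w⊆L) (SimpleClosedWord.closed scw) p<n) moved

  girth-attained : ∀ {w} → All (_∈ L) w → 3 ≤ length w → T (upperCheck w) →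
    ∃ λ v → ∃ λ ws → Cycle n (map (index n) L) v ws × suc (length ws) ≡ length w
  girth-attained {w} w⊆L long check with fixes , separated ← upperCheck-sound check =
    ι , simpleClosedWord⇒cycle L ι-perm w⊆L record
      { long     = long
      ; closed   = Fixes⇒closed ι (proj₁ ι-perm) (fits w⊆L) fixes
      ; distinct = λ {i} {j} i<j j<k →
          Separates⇒≢ ι-perm (take⁺ i (fits w⊆L)) (take⁺ j (fits w⊆L)) (separated i<j j<k)
      }
    where
    ι = allFin n
    ι-perm : IsPerm n ι
    ι-perm = length-tabulate id , allFin⁺ n

  girth-certified : ∀ {w} → All (_∈ L) w → 3 ≤ length w →
                    T (upperCheck w) → T (lowerCheck L (length w)) → GirthIs n (map (index n) L) (length w)
  girth-certified w⊆L long upper lower = girth-attained w⊆L long upper , girth-≥ lower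

exhaustive : ∀ n → Certifier n
exhaustive n = record
  { separates?      = λ u w → isYes (separates? u w)
  ; separates-sound = λ u w → toWitness {a? = separates? u w}
  ; fixes?          = λ w → isYes (fixes? w)
  ; fixes-sound     = λ w → toWitness {a? = fixes? w}
  }
  where
  separates? : ∀ u w → Dec (Separates n u w)
  separates? u w = anyUpTo? (λ p → ¬? (origin n u p ≟ origin n w p)) n
  fixes? : ∀ w → Dec (Fixes n w)
  fixes? w = allUpTo? (λ p → origin n w p ≟ p) n

-- Symbolic positions, uniformly in n

-- Fin 4 rather than a data type, so that decidable equality comes from the library.
Region : Set
Region = Fin 4

pattern front    = zero
pattern back     = suc zero
pattern middle   = suc (suc zero)
pattern reversed = suc (suc (suc zero))

SymPos : Set
SymPos = Region × ℕ

_≟ₛ_ : DecidableEquality SymPos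
_≟ₛ_ = Product.≡-dec Fin._≟_ _≟_

-- The position denoted when the middle block has length m; q < m selects a middle position.
⟦_⟧ : SymPos → ℕ → ℕ → ℕ
⟦ front    , c ⟧ m q = c
⟦ back     , c ⟧ m q = c + m
⟦ middle   , c ⟧ m q = c + q
⟦ reversed , c ⟧ m q = c + (m ∸ suc q)

offset≤⟦⟧ : ∀ ρ c m q → c ≤ ⟦ ρ , c ⟧ m q
offset≤⟦⟧ front    c m q = ≤-refl
offset≤⟦⟧ back     c m q = m≤m+n c m
offset≤⟦⟧ middle   c m q = m≤m+n c q
offset≤⟦⟧ reversed c m q = m≤m+n c (m ∸ suc q)

Reflects : (ℕ → ℕ) → SymPos → SymPos → Set
Reflects i s s' = ∀ {m q} → q < m → mirror (i m) (⟦ s ⟧ m q) ≡ ⟦ s' ⟧ m q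

module _ {t c m : ℕ} where

  front↦back : c < t → mirror (t + m) c ≡ (t ∸ suc c) + m
  front↦back c<t with d , refl ← m≤n⇒∃[o]m+o≡n c<t = begin
    mirror (suc c + d + m) c   ≡⟨ cong (λ i → mirror i c) (+-assoc (suc c) d m) ⟩
    mirror (suc c + (d + m)) c ≡⟨ mirror-+ c (d + m) ⟩
    d + m                      ≡⟨ cong (_+ m) (m+n∸m≡n (suc c) d) ⟨
    (suc c + d ∸ suc c) + m    ∎
    where open ≡-Reasoning

  back↦front : c < t → mirror (t + m) (c + m) ≡ t ∸ suc c
  back↦front c<t with d , refl ← m≤n⇒∃[o]m+o≡n c<t = begin
    mirror (suc c + d + m) (c + m)   ≡⟨ cong (λ i → mirror i (c + m)) (shuffle c d m) ⟩
    mirror (suc (c + m) + d) (c + m) ≡⟨ mirror-+ (c + m) d ⟩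
    d                                ≡⟨ m+n∸m≡n (suc c) d ⟨
    suc c + d ∸ suc c                ∎
    where
    open ≡-Reasoning
    shuffle : ∀ c d m → suc c + d + m ≡ suc (c + m) + d
    shuffle = solve-∀

  middle↦reversed : ∀ {q} → c ≤ t → q < m → mirror (t + m) (c + q) ≡ (t ∸ c) + (m ∸ suc q)
  middle↦reversed {q} c≤t q<m
    with d , refl ← m≤n⇒∃[o]m+o≡n c≤t | r , refl ← m≤n⇒∃[o]m+o≡n q<m = begin
      mirror (c + d + (suc q + r)) (c + q)   ≡⟨ cong (λ i → mirror i (c + q)) (shuffle c d q r) ⟩
      mirror (suc (c + q) + (d + r)) (c + q) ≡⟨ mirror-+ (c + q) (d + r) ⟩
      d + r                                  ≡⟨ cong₂ _+_ (m+n∸m≡n c d) (m+n∸m≡n (suc q) r) ⟨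
      (c + d ∸ c) + (suc q + r ∸ suc q)      ∎
    where
    open ≡-Reasoning
    shuffle : ∀ c d q r → c + d + (suc q + r) ≡ suc (c + q) + (d + r)
    shuffle = solve-∀

  reversed↦middle : ∀ {q} → c ≤ t → q < m → mirror (t + m) (c + (m ∸ suc q)) ≡ (t ∸ c) + q
  reversed↦middle {q} c≤t q<m
    with d , refl ← m≤n⇒∃[o]m+o≡n c≤t | r , refl ← m≤n⇒∃[o]m+o≡n q<m = begin
      mirror (c + d + (suc q + r)) (c + (suc q + r ∸ suc q))
        ≡⟨ cong (λ p → mirror (c + d + (suc q + r)) (c + p)) (m+n∸m≡n (suc q) r) ⟩
      mirror (c + d + (suc q + r)) (c + r)                   ≡⟨ cong (λ i → mirror i (c + r)) (shuffle c d q r) ⟩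
      mirror (suc (c + r) + (d + q)) (c + r)                 ≡⟨ mirror-+ (c + r) (d + q) ⟩
      d + q                                                  ≡⟨ cong (_+ q) (m+n∸m≡n c d) ⟨
      (c + d ∸ c) + q                                        ∎
    where
    open ≡-Reasoning
    shuffle : ∀ c d q r → c + d + (suc q + r) ≡ suc (c + r) + (d + q)
    shuffle = solve-∀

stepSmall : ∀ a s → Maybe (∃ (Reflects (λ _ → a) s))
stepSmall a (front , c) = just ((front , mirror a c) , λ _ → refl)
stepSmall a (ρ , c) with a ≤? c
... | yes a≤c = just ((ρ , c) , λ _ → mirror-≥ (≤-trans a≤c (offset≤⟦⟧ ρ c _ _)))
... | no _    = nothing

stepLarge : ∀ t s → Maybe (∃ (Reflects (t +_) s))
stepLarge t (front , c) with suc c ≤? t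
... | yes c<t = just ((back , t ∸ suc c) , λ _ → front↦back c<t)
... | no _    = nothing
stepLarge t (back , c) with suc c ≤? t
... | yes c<t = just ((front , t ∸ suc c) , λ _ → back↦front c<t)
... | no c≮t  = just ((back , c) , λ _ → mirror-≥ (+-monoˡ-≤ _ (≮⇒≥ c≮t)))
stepLarge t (middle , c) with c ≤? t
... | yes c≤t = just ((reversed , t ∸ c) , middle↦reversed c≤t)
... | no _    = nothing
stepLarge t (reversed , c) with c ≤? t
... | yes c≤t = just ((middle , t ∸ c) , reversed↦middle c≤t)
... | no _    = nothing

step : ∀ N g s → Maybe (∃ (Reflects (λ m → index (N + m) g) s))
step N r[ a ]   s = stepSmall a s
step N r[n- b ] s with b ≤? N
... | yes b≤N = Maybe.map (λ (s' , reflects) → s' , λ {m} {q} q<m →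
                  trans (cong (λ i → mirror i (⟦ s ⟧ m q)) (+-∸-comm m b≤N)) (reflects q<m))
                (stepLarge (N ∸ b) s)
... | no _    = nothing

Tracks : ℕ → Word → SymPos → SymPos → Set
Tracks N w s s' = ∀ {m q} → q < m → origin (N + m) w (⟦ s ⟧ m q) ≡ ⟦ s' ⟧ m q

track : ∀ N w s → Maybe (∃ (Tracks N w s))
track N []      s = just (s , λ _ → refl)
track N (g ∷ w) s = do
  (s' , tracks) ← track N w s
  (s'' , reflects) ← step N g s'
  just (s'' , λ {m} q<m → trans (cong (mirror (index (N + m) g)) (tracks q<m)) (reflects q<m))

Apart : ℕ → SymPos → SymPos → Set
Apart M₀ s s' = ∀ {m} → M₀ ≤ m → ⟦ s ⟧ m 0 ≢ ⟦ s' ⟧ m 0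

front≢back : ∀ {c d M₀ m} → c < d + M₀ → M₀ ≤ m → c ≢ d + m
front≢back {d = d} c<d+M₀ M₀≤m = <⇒≢ (<-≤-trans c<d+M₀ (+-monoʳ-≤ d M₀≤m))

apart : ∀ M₀ s s' → Maybe (Apart M₀ s s')
apart M₀ (front , c) (front , d) = Maybe.map (λ c≢d _ → c≢d) (dec⇒maybe (¬? (c ≟ d)))
apart M₀ (back , c)  (back , d)  =
  Maybe.map (λ c≢d _ → c≢d ∘ +-cancelʳ-≡ _ c d) (dec⇒maybe (¬? (c ≟ d)))
apart M₀ (front , c) (back , d)  = Maybe.map (λ c<d+M₀ M₀≤m → front≢back c<d+M₀ M₀≤m) (dec⇒maybe (c <? d + M₀))
apart M₀ (back , c)  (front , d) =
  Maybe.map (λ d<c+M₀ M₀≤m → ≢-sym (front≢back d<c+M₀ M₀≤m)) (dec⇒maybe (d <? c + M₀))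
apart M₀ _           _           = nothing

SeparatedAt : ℕ → ℕ → Word → Word → SymPos → Set
SeparatedAt N M₀ u w s =
  ∀ {m} → M₀ ≤ m → 0 < m → origin (N + m) u (⟦ s ⟧ m 0) ≢ origin (N + m) w (⟦ s ⟧ m 0)

separatedAt : ∀ N M₀ u w s → Maybe (SeparatedAt N M₀ u w s)
separatedAt N M₀ u w s = do
  (su , tracks-u) ← track N u s
  (sw , tracks-w) ← track N w s
  su≉sw ← apart M₀ su sw
  just λ M₀≤m 0<m eq → su≉sw M₀≤m (trans (sym (tracks-u 0<m)) (trans eq (tracks-w 0<m)))

fixedAt : ∀ N w s → Maybe (Tracks N w s s)
fixedAt N w s = do
  (s' , tracks) ← track N w s
  Maybe.map (λ s'≡s → subst (Tracks N w s) s'≡s tracks) (dec⇒maybe (s' ≟ₛ s))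

data PositionView (K m : ℕ) : ℕ → Set where
  in-front  : ∀ {c} → c < K → PositionView K m c
  in-middle : ∀ {q} → q < m → PositionView K m (K + q)
  in-back   : ∀ {c} → c < K → PositionView K m (K + c + m)

positionView : ∀ K m {p} → p < K + K + m → PositionView K m p
positionView K m {p} p<n with p <? K | p <? K + m
... | yes p<K | _        = in-front p<K
... | no p≮K  | yes p<K+m with q , refl ← m≤n⇒∃[o]m+o≡n (≮⇒≥ p≮K) = in-middle (+-cancelˡ-< K q m p<K+m)
... | no p≮K  | no p≮K+m  with c , refl ← m≤n⇒∃[o]m+o≡n (≮⇒≥ p≮K+m) =
  subst (PositionView K m) (swap-+ K c m)
    (in-back (+-cancelˡ-< (K + m) c K (subst (K + m + c <_) (swap-+ K K m) p<n)))
  where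
  swap-+ : ∀ a b c → a + b + c ≡ a + c + b
  swap-+ = solve-∀

module _ (K M₀ : ℕ) where

  private
    N = K + K

  symSeparates? : Word → Word → Bool
  symSeparates? u w =
    any (λ c → is-just (separatedAt N M₀ u w (front , c)) ∨ is-just (separatedAt N M₀ u w (back , K + c)))
        (upTo K)

  symFixes? : Word → Bool
  symFixes? w =
    is-just (fixedAt N w (middle , K)) ∧
    all (λ c → is-just (fixedAt N w (front , c)) ∧ is-just (fixedAt N w (back , K + c))) (upTo K)

  symbolic : ∀ {m} → M₀ ≤ m → 0 < m → Certifier (N + m)
  symbolic {m} M₀≤m 0<m = record
    { separates?      = symSeparates?
    ; separates-sound = separates-sound
    ; fixes?          = symFixes?
    ; fixes-sound     = fixes-sound
    }
    where
    separates-sound : ∀ u w → T (symSeparates? u w) → Separates (N + m) u w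
    separates-sound u w check with c , c∈ , found ← find (any⁻ _ (upTo K) check)
      | Equivalence.to (T-∨ {is-just (separatedAt N M₀ u w (front , c))}) found
    ... | inj₁ at-front = c , c<n , to-witness-T _ at-front M₀≤m 0<m
      where c<n = <-≤-trans (∈-upTo⁻ c∈) (≤-trans (m≤m+n K K) (m≤m+n N m))
    ... | inj₂ at-back  = K + c + m , c<n , to-witness-T _ at-back M₀≤m 0<m
      where c<n = +-monoˡ-< m (+-monoʳ-< K (∈-upTo⁻ c∈))

    outer-fixed : ∀ w → T (symFixes? w) → ∀ {c} → c < K →
      T (is-just (fixedAt N w (front , c))) × T (is-just (fixedAt N w (back , K + c)))
    outer-fixed w check c<K =
      Equivalence.to T-∧ (All.lookup (all⁺ _ (upTo K) (proj₂ (Equivalence.to T-∧ check))) (∈-upTo⁺ c<K))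

    fixes-sound : ∀ w → T (symFixes? w) → Fixes (N + m) w
    fixes-sound w check p<n with positionView K m p<n
    ... | in-front c<K  = to-witness-T _ (proj₁ (outer-fixed w check c<K)) 0<m
    ... | in-middle q<m = to-witness-T (fixedAt N w (middle , K)) (proj₁ (Equivalence.to T-∧ check)) q<m
    ... | in-back c<K   = to-witness-T _ (proj₂ (outer-fixed w check c<K)) 0<m

-- The five families

open import Data.List.Membership.DecPropositional _≟ₗ_ using (_∈?_)

_^_ : Word → ℕ → Word
u ^ k = concat (replicate k u)

minDegree : Letter → ℕ
minDegree r[ a ]   = a
minDegree r[n- _ ] = 0

minDegree≤⇒fits : ∀ {n} g → minDegree g ≤ n → index n g ≤ n
minDegree≤⇒fits         r[ a ]   a≤n = a≤n
minDegree≤⇒fits {n = n} r[n- b ] _   = m∸n≤m n b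

girth-by : ∀ {n} (C : Certifier n) L w
  {_ : True (All.all? (λ g → minDegree g ≤? n) L)}
  {_ : True (All.all? (_∈? L) w)}
  {_ : True (3 ≤? length w)}
  {_ : T (Certifier.upperCheck C w)}
  {_ : T (Certifier.lowerCheck C L (length w))} →
  GirthIs n (map (index n) L) (length w)
girth-by C L w {fits} {w⊆L} {long} {upper} {lower} =
  girth-certified C (All.map (λ {g} → minDegree≤⇒fits g) (toWitness fits)) (toWitness w⊆L) (toWitness long)
    upper lower

odd⇒¬even : ∀ {n} → Odd n → ¬ Even n
odd⇒¬even (j , refl) (k , eq) = even≢odd k j (sym eq)

beyond : ∀ {P : ℕ → Set} k → (∀ m → P (k + m)) → ∀ {n} → k ≤ n → P n
beyond k f k≤n with m , refl ← m≤n⇒∃[o]m+o≡n k≤n = f m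

L₁ L₂ L₃ L₄ L₅ : List Letter
L₁ = r[ 2 ] ∷ r[n- 1 ] ∷ r[n- 0 ] ∷ []
L₂ = r[n- 2 ] ∷ r[n- 1 ] ∷ r[n- 0 ] ∷ []
L₃ = r[ 3 ] ∷ r[n- 2 ] ∷ r[n- 0 ] ∷ []
L₄ = r[ 3 ] ∷ r[n- 1 ] ∷ r[n- 0 ] ∷ []
L₅ = r[n- 3 ] ∷ r[n- 1 ] ∷ r[n- 0 ] ∷ []

W₁ W₂ W₃ W₄ W₅ : Word
W₁ = (r[n- 0 ] ∷ r[ 2 ] ∷ []) ^ 4
W₂ = (r[n- 0 ] ∷ r[n- 1 ] ∷ r[n- 2 ] ∷ r[n- 1 ] ∷ []) ^ 2
W₃ = (r[n- 0 ] ∷ r[ 3 ] ∷ []) ^ 4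
W₄ = (r[n- 0 ] ∷ r[n- 1 ] ∷ r[ 3 ] ∷ r[n- 1 ] ∷ []) ^ 2
W₅ = (r[n- 0 ] ∷ r[n- 1 ] ∷ r[n- 0 ] ∷ r[n- 1 ] ∷ r[n- 3 ] ∷ r[n- 1 ] ∷ []) ^ 2

girth-P₁ : ∀ n → 5 ≤ n → GirthIs n (P1 n) 8
girth-P₁ _ = beyond {λ n → GirthIs n (P1 n) 8} 5 λ where
  0             → girth-by (exhaustive 5) L₁ W₁
  1             → girth-by (exhaustive 6) L₁ W₁
  (suc (suc m)) → girth-by (symbolic 3 1 {suc m} (s≤s z≤n) z<s) L₁ W₁

girth-P₂ : ∀ n → 5 ≤ n → GirthIs n (P2 n) 8
girth-P₂ _ = beyond {λ n → GirthIs n (P2 n) 8} 5 λ where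
  0             → girth-by (exhaustive 5) L₂ W₂
  1             → girth-by (exhaustive 6) L₂ W₂
  (suc (suc m)) → girth-by (symbolic 3 1 {suc m} (s≤s z≤n) z<s) L₂ W₂

girth-P₃ : ∀ n → 5 ≤ n → Even n → GirthIs n (P3 n) 8
girth-P₃ _ = beyond {λ n → Even n → GirthIs n (P3 n) 8} 5 λ where
  0                         → λ even → contradiction even (odd⇒¬even (2 , refl))
  1                         → λ _ → girth-by (exhaustive 6) L₃ W₃
  2                         → λ even → contradiction even (odd⇒¬even (3 , refl))
  3                         → λ _ → girth-by (exhaustive 8) L₃ W₃
  (suc (suc (suc (suc m)))) → λ _ → girth-by (symbolic 4 1 {suc m} (s≤s z≤n) z<s) L₃ W₃

girth-P₄ : ∀ n → 5 ≤ n → Odd n → GirthIs n (P4 n) 8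
girth-P₄ _ = beyond {λ n → Odd n → GirthIs n (P4 n) 8} 5 λ where
  0             → λ _ → girth-by (exhaustive 5) L₄ W₄
  1             → λ odd → contradiction (3 , refl) (odd⇒¬even odd)
  (suc (suc m)) → λ _ → girth-by (symbolic 3 1 {suc m} (s≤s z≤n) z<s) L₄ W₃

girth-P₅ : ∀ n → 7 ≤ n → Odd n → GirthIs n (P5 n) 12
girth-P₅ _ = beyond {λ n → Odd n → GirthIs n (P5 n) 12} 7 λ where
  0 → λ _ → girth-by (exhaustive 7) L₅ W₅
  1 → λ odd → contradiction (4 , refl) (odd⇒¬even odd)
  2 → λ _ → girth-by (exhaustive 9) L₅ W₅
  3 → λ odd → contradiction (5 , refl) (odd⇒¬even odd)
  4 → λ _ → girth-by (exhaustive 11) L₅ W₅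
  5 → λ odd → contradiction (6 , refl) (odd⇒¬even odd)
  6 → λ _ → girth-by (exhaustive 13) L₅ W₅
  (suc (suc (suc (suc (suc (suc (suc m))))))) →
    λ _ → girth-by (symbolic 6 2 {suc (suc m)} (s≤s (s≤s z≤n)) z<s) L₅ W₅

theorem1 :
    -- (i)
    (GirthIs 4 (P1 4) 6 × (∀ n → 5 ≤ n → GirthIs n (P1 n) 8))
    × (GirthIs 4 (P2 4) 6 × (∀ n → 5 ≤ n → GirthIs n (P2 n) 8))
    × (GirthIs 4 (P3 4) 6 × (∀ n → 5 ≤ n → Even n → GirthIs n (P3 n) 8))
    -- (ii)
    × (∀ n → 5 ≤ n → Odd n → GirthIs n (P4 n) 8)
    -- (iii)
    × (GirthIs 5 (P5 5) 8 × (∀ n → 7 ≤ n → Odd n → GirthIs n (P5 n) 12))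
theorem1 =
  (girth-by (exhaustive 4) L₁ ((r[n- 1 ] ∷ r[ 2 ] ∷ []) ^ 3) , girth-P₁) ,
  (girth-by (exhaustive 4) L₂ ((r[n- 1 ] ∷ r[n- 2 ] ∷ []) ^ 3) , girth-P₂) ,
  (girth-by (exhaustive 4) L₃ ((r[n- 2 ] ∷ r[ 3 ] ∷ []) ^ 3) , girth-P₃) ,
  girth-P₄ ,
  (girth-by (exhaustive 5) L₅ ((r[n- 0 ] ∷ r[n- 3 ] ∷ []) ^ 4) , girth-P₅)
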